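{- For every positive integer $n$, the call $\mathrm{RecAsc}(n,1,1)$ results in exactly $p(n)$ invocations of $\mathrm{RecAsc}$ in total, counting the initial call and all recursive calls.
   Context: $p(n)$ denotes the number of partitions of $n$. The recursive procedure $\mathrm{RecAsc}(n,m,k)$, with precondition $1\le m\le n$, operates on a global array $a$ as follows: 1. $x\leftarrow m$. 2. While $2x\le n$: set $a_k\leftarrow x$; call $\mathrm{RecAsc}(n-x,x,k+1)$; set $x\leftarrow x+1$. 3. $a_k\leftarrow n$. 4. Visit (output) $\langle a_1,\dots,a_k\rangle$. -}

module Defs where

open import Data.Nat using (ℕ; zero; suc; _+_; _*_; _∸_; _≤_; _≥_; _≤?_)
open import Data.List using (List)
open import Data.Nat.ListAction using (sum)
open import Data.List.Relation.Unary.All using (All)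
open import Data.List.Relation.Unary.Linked using (Linked)
open import Relation.Binary.PropositionalEquality using (_≡_)
open import Relation.Nullary using (yes; no)

-- A partition of n: a weakly decreasing list of positive integers summing to n.
-- p(n) is the cardinality of the type Partition n.
record Partition (n : ℕ) : Set where
  constructor mkPartition
  field
    parts    : List ℕ
    positive : All (λ x → 1 ≤ x) parts
    nonincr  : Linked _≥_ parts
    sums     : sum parts ≡ n

-- Number of invocations of RecAsc performed by a call RecAsc(n, m, k),
-- counting the call itself and all recursive calls (the array a and the
-- index k do not influence control flow, so they are omitted).
-- Structural recursion is achieved with explicit fuel:
--   recAscCalls f n m  = number of calls made by RecAsc(n,m,_)  (fuel f)
--   loopCalls f n x s  = calls made by the while loop starting at x,
--                        with at most s further iterations.
mutual
  recAscCalls : ℕ → ℕ → ℕ → ℕ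
  recAscCalls zero    n m = 0
  recAscCalls (suc f) n m = suc (loopCalls f n m n)

  loopCalls : ℕ → ℕ → ℕ → ℕ → ℕ
  loopCalls f n x zero    = 0
  loopCalls f n x (suc s) with 2 * x ≤? n
  ... | yes _ = recAscCalls f (n ∸ x) x + loopCalls f n (suc x) s
  ... | no  _ = 0

-- Total number of invocations caused by RecAsc(n, m, 1), with fuel n+1,
-- which suffices when 1 ≤ m ≤ n: the recursion depth is at most n
-- (each recursive call decreases n by x ≥ m ≥ 1) and the loop runs at most
-- n/2 ≤ n times.
RecAscCount : ℕ → ℕ → ℕ
RecAscCount n m = recAscCalls (suc n) n m

module Submission where

-- Each invocation of RecAsc(n,m,k) visits exactly one composition, so the
-- calls made by RecAsc(n,m,_) correspond to the ascending compositions of n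
-- with all parts ≥ m.  The theorem is a composite of three bijections:
--   1. counting: Fin (recAscCalls f n m) ↔ Asc n m, by induction on the fuel
--      f, with the while loop started at x counting the branches whose first
--      part is ≥ x;
--   2. listing: Asc n m ↔ AscList n m, the nondecreasing lists of parts ≥ m
--      with sum n;
--   3. reversal: AscList n 1 ↔ Partition n, since reversing a nondecreasing
--      list of positive parts gives a nonincreasing one.

open import Defs
open import Data.Nat using (ℕ; zero; suc; _+_; _*_; _∸_; _≤_; _<_; _≟_; _≤?_; z≤n; s≤s)
open import Data.Fin using (Fin)
open import Data.Nat.Properties
open import Data.Nat.ListAction using (sum)
open import Data.Nat.ListAction.Properties using (sum-↭)
open import Data.Fin.Properties using (+↔⊎; 1↔⊤)
open import Data.Unit using (⊤; tt)
open import Data.Sum using (_⊎_; inj₁; inj₂)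
open import Data.Sum.Algebra using (⊎-cong)
open import Data.List using (List; []; _∷_; reverse; reverseAcc)
open import Data.List.Properties using (reverse-involutive)
open import Data.List.Relation.Unary.All as All using (All; []; _∷_)
open import Data.List.Relation.Unary.Linked as Linked using (Linked; []; [-]; _∷_)
open import Data.List.Relation.Binary.Permutation.Propositional using (↭-sym)
open import Data.List.Relation.Binary.Permutation.Propositional.Properties
  using (↭-reverse; All-resp-↭)
open import Function using (flip)
open import Function.Bundles using (_↔_; mk↔ₛ′)
open import Function.Properties.Inverse using (↔-refl)
open import Function.Related.Propositional using (module EquationalReasoning)
open import Relation.Binary.PropositionalEquality
open import Relation.Nullary using (¬_; yes; no; contradiction)

open EquationalReasoning

suc↔⊤⊎ : (k : ℕ) → Fin (suc k) ↔ (⊤ ⊎ Fin k)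
suc↔⊤⊎ k = begin
  Fin (suc k)     ↔⟨ +↔⊎ {1} ⟩
  (Fin 1 ⊎ Fin k) ↔⟨ ⊎-cong 1↔⊤ ↔-refl ⟩
  (⊤ ⊎ Fin k)     ∎

0↔empty : {B : Set} → ¬ B → Fin 0 ↔ B
0↔empty ¬b = mk↔ₛ′ (λ ()) (λ b → contradiction b ¬b) (λ b → contradiction b ¬b) (λ ())

half≤ : ∀ {x n} → 2 * x ≤ n → x ≤ n
half≤ {x} 2x≤n = ≤-trans (m≤m+n x (x + 0)) 2x≤n

half≤rest : ∀ {x n} → 2 * x ≤ n → x ≤ n ∸ x
half≤rest {x} {n} 2x≤n =
  subst (_≤ n ∸ x) (trans (m+n∸m≡n x (x + 0)) (+-identityʳ x)) (∸-monoˡ-≤ x 2x≤n)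

-- Ascending compositions of n with all parts ≥ m, shaped like the call tree
-- of RecAsc(n,m,_): 'whole' is the composition ⟨n⟩, and a branch records the
-- loop value x chosen as first part together with the rest of the
-- composition, produced by the recursive call RecAsc(n ∸ x, x, _).
mutual
  data Asc (n m : ℕ) : Set where
    whole : Asc n m
    split : Branch n m → Asc n m

  record Branch (n m : ℕ) : Set where
    inductive
    constructor branch
    field
      first : ℕ
      lower : m ≤ first
      half  : 2 * first ≤ n
      rest  : Asc (n ∸ first) first

⊤⊎Branch↔Asc : ∀ {n m} → (⊤ ⊎ Branch n m) ↔ Asc n m
⊤⊎Branch↔Asc {n} {m} = mk↔ₛ′ to from to-from from-to
  where
  to : ⊤ ⊎ Branch n m → Asc n m
  to (inj₁ _) = whole
  to (inj₂ b) = split b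
  from : Asc n m → ⊤ ⊎ Branch n m
  from whole     = inj₁ tt
  from (split b) = inj₂ b
  to-from : ∀ a → to (from a) ≡ a
  to-from whole     = refl
  to-from (split b) = refl
  from-to : ∀ s → from (to s) ≡ s
  from-to (inj₁ tt) = refl
  from-to (inj₂ b)  = refl

branch-≡ : ∀ {n m x} {p p′ : m ≤ x} {q q′ : 2 * x ≤ n} {r r′ : Asc (n ∸ x) x} →
           r ≡ r′ → branch x p q r ≡ branch x p′ q′ r′
branch-≡ {p = p} {p′} {q} {q′} refl
  rewrite ≤-irrelevant p p′ | ≤-irrelevant q q′ = refl

Branch-empty : ∀ {n x} → ¬ (2 * x ≤ n) → ¬ Branch n x
Branch-empty ¬2x≤n (branch y x≤y 2y≤n _) = ¬2x≤n (≤-trans (*-monoʳ-≤ 2 x≤y) 2y≤n)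

-- One loop iteration: a branch with first part ≥ x has first part exactly x
-- (the recursive call for x) or has first part ≥ x + 1 (the rest of the loop).
Branch-step : ∀ {n x} → 2 * x ≤ n → (Asc (n ∸ x) x ⊎ Branch n (suc x)) ↔ Branch n x
Branch-step {n} {x} 2x≤n = mk↔ₛ′ to from to-from from-to
  where
  to : Asc (n ∸ x) x ⊎ Branch n (suc x) → Branch n x
  to (inj₁ r)                    = branch x ≤-refl 2x≤n r
  to (inj₂ (branch y x<y 2y≤n r)) = branch y (<⇒≤ x<y) 2y≤n r
  from : Branch n x → Asc (n ∸ x) x ⊎ Branch n (suc x)
  from (branch y x≤y 2y≤n r) with x ≟ y
  ... | yes refl = inj₁ r
  ... | no  x≢y  = inj₂ (branch y (≤∧≢⇒< x≤y x≢y) 2y≤n r)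
  to-from : ∀ b → to (from b) ≡ b
  to-from (branch y x≤y 2y≤n r) with x ≟ y
  ... | yes refl = branch-≡ refl
  ... | no  _    = branch-≡ refl
  from-to : ∀ s → from (to s) ≡ s
  from-to (inj₁ r) with x ≟ x
  ... | yes refl = refl
  ... | no  x≢x  = contradiction refl x≢x
  from-to (inj₂ (branch y x<y 2y≤n r)) with x ≟ y
  ... | yes refl = contradiction x<y (<-irrefl refl)
  ... | no  _    = cong inj₂ (branch-≡ refl)

-- The fuel bound n < f decreases along recursive calls since
-- x ≥ 1, and the bound n < 2(x + s) guarantees the loop ends by 2x > n.

start-bound : ∀ {m} n → 1 ≤ m → n < 2 * (m + n)
start-bound {m} n 1≤m = <-≤-trans (m<n+m n 1≤m) (m≤n*m (m + n) 2)

mutual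
  calls↔Asc : ∀ f n m → 1 ≤ m → n < f → Fin (recAscCalls f n m) ↔ Asc n m
  calls↔Asc (suc f) n m 1≤m (s≤s n≤f) = begin
    Fin (suc (loopCalls f n m n)) ↔⟨ suc↔⊤⊎ _ ⟩
    (⊤ ⊎ Fin (loopCalls f n m n)) ↔⟨ ⊎-cong ↔-refl loop ⟩
    (⊤ ⊎ Branch n m)              ↔⟨ ⊤⊎Branch↔Asc ⟩
    Asc n m                       ∎
    where
    loop : Fin (loopCalls f n m n) ↔ Branch n m
    loop = loop↔Branch f n m n 1≤m n≤f (start-bound n 1≤m)

  loop↔Branch : ∀ f n x s → 1 ≤ x → n ≤ f → n < 2 * (x + s) →
                Fin (loopCalls f n x s) ↔ Branch n x
  loop↔Branch f n x zero _ _ n<2x =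
    0↔empty (Branch-empty (<⇒≱ (subst (λ k → n < 2 * k) (+-identityʳ x) n<2x)))
  loop↔Branch f n x (suc s) 1≤x n≤f n<2[x+s] with 2 * x ≤? n
  ... | no  ¬2x≤n = 0↔empty (Branch-empty ¬2x≤n)
  ... | yes 2x≤n  = begin
    Fin (here + later)                 ↔⟨ +↔⊎ ⟩
    (Fin here ⊎ Fin later)             ↔⟨ ⊎-cong (calls↔Asc f (n ∸ x) x 1≤x rest<f)
                                                 (loop↔Branch f n (suc x) s (s≤s z≤n) n≤f bound) ⟩
    (Asc (n ∸ x) x ⊎ Branch n (suc x)) ↔⟨ Branch-step 2x≤n ⟩
    Branch n x                         ∎
    where
    here later : ℕ
    here  = recAscCalls f (n ∸ x) x
    later = loopCalls f n (suc x) s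
    rest<f : n ∸ x < f
    rest<f = <-≤-trans (∸-monoʳ-< 1≤x (half≤ 2x≤n)) n≤f
    bound : n < 2 * (suc x + s)
    bound = subst (λ k → n < 2 * k) (+-suc x s) n<2[x+s]

-- Listing.  The parts of an ascending composition, first part separated so
-- that the list is visibly nonempty.

firstPart : ∀ {n m} → Asc n m → ℕ
firstPart {n} whole                = n
firstPart (split (branch x _ _ _)) = x

laterParts : ∀ {n m} → Asc n m → List ℕ
laterParts whole                    = []
laterParts (split (branch _ _ _ r)) = firstPart r ∷ laterParts r

parts : ∀ {n m} → Asc n m → List ℕ
parts a = firstPart a ∷ laterParts a

record AscList (n m : ℕ) : Set where
  constructor mkAscList
  field
    list      : List ℕ
    bounded   : All (m ≤_) list
    ascending : Linked _≤_ list
    total     : sum list ≡ n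

-- The proof fields are propositions, so an AscList is determined by its list.
AscList-≡ : ∀ {n m} {a b : AscList n m} → AscList.list a ≡ AscList.list b → a ≡ b
AscList-≡ {a = mkAscList xs p l s} {mkAscList .xs p′ l′ s′} refl
  rewrite All.irrelevant ≤-irrelevant p p′ | Linked.irrelevant ≤-irrelevant l l′
        | ≡-irrelevant s s′ = refl

parts-bounded : ∀ {n m} (a : Asc n m) → m ≤ n → All (m ≤_) (parts a)
parts-bounded whole m≤n = m≤n ∷ []
parts-bounded (split (branch x m≤x 2x≤n r)) _ =
  m≤x ∷ All.map (≤-trans m≤x) (parts-bounded r (half≤rest 2x≤n))

parts-ascending : ∀ {n m} (a : Asc n m) → m ≤ n → Linked _≤_ (parts a)
parts-ascending whole _ = [-]
parts-ascending (split (branch x _ 2x≤n r)) _ =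
  All.head (parts-bounded r (half≤rest 2x≤n)) ∷ parts-ascending r (half≤rest 2x≤n)

parts-sum : ∀ {n m} (a : Asc n m) → sum (parts a) ≡ n
parts-sum {n} whole = +-identityʳ n
parts-sum (split (branch x _ 2x≤n r)) =
  trans (cong (x +_) (parts-sum r)) (m+[n∸m]≡n (half≤ {x} 2x≤n))

-- Conversely a nondecreasing list x ∷ xs with x ≥ m and sum n determines an
-- ascending composition: for a further part y ≥ x we get 2x ≤ x + y ≤ n.
fromParts : ∀ {n m} x xs → m ≤ x → Linked _≤_ (x ∷ xs) → sum (x ∷ xs) ≡ n → Asc n m
fromParts x [] _ _ _ = whole
fromParts {n} x (y ∷ ys) m≤x (x≤y ∷ l) total =
  split (branch x m≤x 2x≤n (fromParts y ys x≤y l rest-total))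
  where
  2x≤n : 2 * x ≤ n
  2x≤n = subst (2 * x ≤_) total (+-monoʳ-≤ x (+-mono-≤ x≤y z≤n))
  rest-total : sum (y ∷ ys) ≡ n ∸ x
  rest-total = trans (sym (m+n∸m≡n x (sum (y ∷ ys)))) (cong (_∸ x) total)

parts-fromParts : ∀ {n m} x xs (m≤x : m ≤ x) l total →
                  parts (fromParts {n} x xs m≤x l total) ≡ x ∷ xs
parts-fromParts x [] _ _ total = cong (_∷ []) (trans (sym total) (+-identityʳ x))
parts-fromParts x (y ∷ ys) _ (x≤y ∷ l) _ = cong (x ∷_) (parts-fromParts y ys x≤y l _)

fromParts-parts : ∀ {n m} (a : Asc n m) m≤x l total →
                  fromParts (firstPart a) (laterParts a) m≤x l total ≡ a
fromParts-parts whole _ _ _ = refl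
fromParts-parts (split (branch x _ _ r)) _ (x≤y ∷ l) _ =
  cong split (branch-≡ (fromParts-parts r x≤y l _))

-- For 1 ≤ n a list summing to n is nonempty, and m ≤ n makes the single
-- part of 'whole' respect the lower bound m.
Asc↔AscList : ∀ {n m} → 1 ≤ n → m ≤ n → Asc n m ↔ AscList n m
Asc↔AscList {suc n} {m} (s≤s z≤n) m≤n = mk↔ₛ′ to from to-from from-to
  where
  to : Asc (suc n) m → AscList (suc n) m
  to a = mkAscList (parts a) (parts-bounded a m≤n) (parts-ascending a m≤n) (parts-sum a)
  from : AscList (suc n) m → Asc (suc n) m
  from (mkAscList [] _ _ ())
  from (mkAscList (x ∷ xs) bounded l total) = fromParts x xs (All.head bounded) l total
  to-from : ∀ b → to (from b) ≡ b
  to-from (mkAscList [] _ _ ())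
  to-from (mkAscList (x ∷ xs) bounded l total) =
    AscList-≡ (parts-fromParts x xs (All.head bounded) l total)
  from-to : ∀ a → from (to a) ≡ a
  from-to a = fromParts-parts a _ _ _

-- Reversal.  Reversing a list flips the relation linking neighbours; the
-- accumulator version is the induction hypothesis needed for reverse.

Linked-reverseAcc : ∀ {R : ℕ → ℕ → Set} x xs acc → Linked R (x ∷ xs) →
                    Linked (flip R) (x ∷ acc) → Linked (flip R) (reverseAcc (x ∷ acc) xs)
Linked-reverseAcc x []       acc _          done = done
Linked-reverseAcc x (y ∷ ys) acc (Rxy ∷ l) done = Linked-reverseAcc y ys (x ∷ acc) l (Rxy ∷ done)

Linked-reverse : ∀ {R : ℕ → ℕ → Set} xs → Linked R xs → Linked (flip R) (reverse xs)
Linked-reverse []       _ = []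
Linked-reverse (x ∷ xs) l = Linked-reverseAcc x xs [] l [-]

Partition-≡ : ∀ {n} {p q : Partition n} → Partition.parts p ≡ Partition.parts q → p ≡ q
Partition-≡ {p = mkPartition xs p l s} {mkPartition .xs p′ l′ s′} refl
  rewrite All.irrelevant ≤-irrelevant p p′ | Linked.irrelevant ≤-irrelevant l l′
        | ≡-irrelevant s s′ = refl

AscList↔Partition : ∀ {n} → AscList n 1 ↔ Partition n
AscList↔Partition {n} = mk↔ₛ′ to from to-from from-to
  where
  to : AscList n 1 → Partition n
  to (mkAscList xs p l s) = mkPartition (reverse xs)
    (All-resp-↭ (↭-sym (↭-reverse xs)) p) (Linked-reverse xs l) (trans (sum-↭ (↭-reverse xs)) s)
  from : Partition n → AscList n 1
  from (mkPartition xs p l s) = mkAscList (reverse xs)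
    (All-resp-↭ (↭-sym (↭-reverse xs)) p) (Linked-reverse xs l) (trans (sum-↭ (↭-reverse xs)) s)
  to-from : ∀ q → to (from q) ≡ q
  to-from q = Partition-≡ (reverse-involutive (Partition.parts q))
  from-to : ∀ a → from (to a) ≡ a
  from-to a = AscList-≡ (reverse-involutive (AscList.list a))

theorem2p1 : (n : ℕ) → 1 ≤ n → Fin (RecAscCount n 1) ↔ Partition n
theorem2p1 n 1≤n = begin
  Fin (RecAscCount n 1) ↔⟨ calls↔Asc (suc n) n 1 ≤-refl ≤-refl ⟩
  Asc n 1               ↔⟨ Asc↔AscList 1≤n 1≤n ⟩
  AscList n 1           ↔⟨ AscList↔Partition ⟩
  Partition n           ∎
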